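{- Let $(a_n)_{n\ge 0}$ be the Narayana sequence, defined by $a_0=0$, $a_1=a_2=1$ and $a_n=a_{n-1}+a_{n-3}$ for all $n\ge 3$. For all integers $s\ge 1$ and $n\ge 2$, $$\begin{aligned} a_{8s3^{n}} &\equiv 3^{n+3}\cdot 2s+3^{n+2}\cdot 2s \pmod{3^{n+4}},\\ a_{8s3^{n}+1} &\equiv 3^{n+2}\cdot 5s+3^{n+1}\cdot s+1 \pmod{3^{n+4}},\\ a_{8s3^{n}+2} &\equiv 3^{n+3}\cdot 2s+3^{n+2}\cdot 5s+1 \pmod{3^{n+4}}. \end{aligned}$$ -}

module Defs where

open import Data.Nat using (ℕ; zero; suc; _+_)
open import Data.Integer using (ℤ; +_; _-_)
open import Data.Integer.Divisibility using (_∣_)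

narayana : ℕ → ℕ
narayana 0 = 0
narayana 1 = 1
narayana 2 = 1
narayana (suc (suc (suc n))) = narayana (suc (suc n)) + narayana n

_≡_[mod_] : ℕ → ℕ → ℕ → Set
a ≡ b [mod m ] = (+ m) ∣ ((+ a) - (+ b))

-- Work in ℕ[ξ] = ℕ[X]/(X³ − X² − 1), in which ξ^(N+3) = a(N+1) + a(N) ξ + a(N+2) ξ².
-- A direct computation gives ξ^72 ≡ 1 + 27 B (mod 3⁶) with B = 19 + 7ξ + 17ξ². If
-- x ≡ 1 + 27w·u (mod 729w), then x³ ≡ 1 + 27(3w)·u (mod 729(3w)) and x^s ≡ 1 + 27w·su
-- (mod 729w); hence ξ^(8s·3ⁿ) ≡ 1 + 3^(n+1) s·B (mod 3^(n+4)) for n ≥ 2, and multiplying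
-- by ξ³ and reading off the three coefficients gives the congruences.
module Submission where

open import Data.Nat using (ℕ; zero; suc; _+_; _*_; _^_; _∸_; _≥_; s≤s; z≤n)
open import Data.Nat.Properties
  using (+-comm; +-assoc; *-comm; *-assoc; m≤m+n; m+n∸m≡n; ^-distribˡ-+-*)
open import Data.Nat.Divisibility using (m∣m*n) renaming (_∣_ to _∣ℕ_)
open import Data.Nat.Solver using (module +-*-Solver)
open import Data.Integer using (+_; ∣_∣; _⊖_) renaming (_-_ to _-ℤ_)
open import Data.Integer.Properties using ([+m]-[+n]≡m⊖n; ⊖-≥)
open import Data.Fin using (zero; suc; _↑ˡ_; _↑ʳ_; combine)
open import Data.Vec using (Vec; []; _∷_; _++_; concat; map; tabulate)
open import Data.Product using (_×_; _,_; proj₁; proj₂; uncurry)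
open import Relation.Binary.PropositionalEquality
open import Defs

open +-*-Solver using (Polynomial; Normal; con; var; _:+_; _:*_; ⟦_⟧; ⟦_⟧N; normalise; prove)

record Triple (A : Set) : Set where
  constructor ⟨_,_,_⟩
  field c₀ c₁ c₂ : A
open Triple

-- The elements and operations of ℕ[ξ] are defined over any coefficients with numerals,
-- + and *, so that they apply verbatim to ring-solver syntax as well as to ℕ.
record Arithmetic (A : Set) : Set where
  infix  10 #_
  infixl 6 _+ᴬ_
  infixl 7 _*ᴬ_
  field
    #_        : ℕ → A
    _+ᴬ_ _*ᴬ_ : A → A → A
open Arithmetic {{...}}

instance
  ℕ-arithmetic : Arithmetic ℕ
  ℕ-arithmetic = record { #_ = λ n → n ; _+ᴬ_ = _+_ ; _*ᴬ_ = _*_ }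

  polynomial-arithmetic : ∀ {n} → Arithmetic (Polynomial n)
  polynomial-arithmetic = record { #_ = con ; _+ᴬ_ = _:+_ ; _*ᴬ_ = _:*_ }

-- ⟨ r , q , p ⟩ stands for r + qξ + pξ², with ξ³ = ξ² + 1.
module _ {A : Set} {{_ : Arithmetic A}} where
  infixl 6 _⊕_
  infixl 7 _⊗_
  infixr 8 _·_
  infixl 9 _^⊗_

  _⊕_ : Triple A → Triple A → Triple A
  ⟨ a , b , c ⟩ ⊕ ⟨ d , e , f ⟩ = ⟨ a +ᴬ d , b +ᴬ e , c +ᴬ f ⟩

  _·_ : A → Triple A → Triple A
  k · ⟨ a , b , c ⟩ = ⟨ k *ᴬ a , k *ᴬ b , k *ᴬ c ⟩

  _⊗_ : Triple A → Triple A → Triple A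
  ⟨ r₁ , q₁ , p₁ ⟩ ⊗ ⟨ r₂ , q₂ , p₂ ⟩ =
    ⟨ r₁ *ᴬ r₂ +ᴬ q₁ *ᴬ p₂ +ᴬ p₁ *ᴬ q₂ +ᴬ p₁ *ᴬ p₂
    , r₁ *ᴬ q₂ +ᴬ q₁ *ᴬ r₂ +ᴬ p₁ *ᴬ p₂
    , r₁ *ᴬ p₂ +ᴬ q₁ *ᴬ q₂ +ᴬ p₁ *ᴬ r₂ +ᴬ q₁ *ᴬ p₂ +ᴬ p₁ *ᴬ q₂ +ᴬ p₁ *ᴬ p₂ ⟩

  0ξ 1ξ ξ : Triple A
  0ξ = ⟨ # 0 , # 0 , # 0 ⟩
  1ξ = ⟨ # 1 , # 0 , # 0 ⟩
  ξ  = ⟨ # 0 , # 1 , # 0 ⟩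

  _^⊗_ : Triple A → ℕ → Triple A
  x ^⊗ zero  = 1ξ
  x ^⊗ suc n = x ⊗ x ^⊗ n

ℕ[ξ] : Set
ℕ[ξ] = Triple ℕ

-- Identities in ℕ[ξ] are proved coefficientwise by the ℕ ring solver: j scalar and k
-- ℕ[ξ]-valued variables become j + 3k solver variables.
module _ {j k : ℕ} where
  private
    P = Polynomial (j + k * 3)

  variables : Vec P j × Vec (Triple P) k
  variables =
    tabulate (λ i → var (i ↑ˡ k * 3)) ,
    tabulate (λ i → ⟨ var (j ↑ʳ combine i zero)
                    , var (j ↑ʳ combine i (suc zero))
                    , var (j ↑ʳ combine i (suc (suc zero))) ⟩)

  environment : Vec ℕ j → Vec ℕ[ξ] k → Vec ℕ (j + k * 3)
  environment σ xs = σ ++ concat (map (λ x → c₀ x ∷ c₁ x ∷ c₂ x ∷ []) xs)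

  ⟦_⟧³ : Triple P → Vec ℕ (j + k * 3) → ℕ[ξ]
  ⟦ ⟨ a , b , c ⟩ ⟧³ ρ = ⟨ ⟦ a ⟧ ρ , ⟦ b ⟧ ρ , ⟦ c ⟧ ρ ⟩

  normalise³ : Triple P → Triple (Normal (j + k * 3))
  normalise³ ⟨ a , b , c ⟩ = ⟨ normalise a , normalise b , normalise c ⟩

  ℕ[ξ]-solve : (σ : Vec ℕ j) (xs : Vec ℕ[ξ] k)
    (f : Vec P j → Vec (Triple P) k → Triple P × Triple P) →
    let (l , r) = uncurry f variables in
    normalise³ l ≡ normalise³ r → ⟦ l ⟧³ (environment σ xs) ≡ ⟦ r ⟧³ (environment σ xs)
  ℕ[ξ]-solve σ xs f same-normal-form =
    cong-⟨⟩ (agree (c₀ l) (c₀ r) (cong c₀ same-normal-form))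
            (agree (c₁ l) (c₁ r) (cong c₁ same-normal-form))
            (agree (c₂ l) (c₂ r) (cong c₂ same-normal-form))
    where
      ρ = environment σ xs
      l = proj₁ (uncurry f variables)
      r = proj₂ (uncurry f variables)
      agree : ∀ p q → normalise p ≡ normalise q → ⟦ p ⟧ ρ ≡ ⟦ q ⟧ ρ
      agree p q same = prove ρ p q (cong (λ n → ⟦ n ⟧N ρ) same)
      cong-⟨⟩ : ∀ {a b c d e f} → a ≡ d → b ≡ e → c ≡ f → ⟨ a , b , c ⟩ ≡ ⟨ d , e , f ⟩
      cong-⟨⟩ refl refl refl = refl

⊗-identityˡ : ∀ (x : ℕ[ξ]) → 1ξ ⊗ x ≡ x
⊗-identityˡ x = ℕ[ξ]-solve [] (x ∷ []) (λ { [] (x ∷ []) → 1ξ ⊗ x , x }) refl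

⊗-assoc : ∀ (x y z : ℕ[ξ]) → (x ⊗ y) ⊗ z ≡ x ⊗ (y ⊗ z)
⊗-assoc x y z =
  ℕ[ξ]-solve [] (x ∷ y ∷ z ∷ []) (λ { [] (x ∷ y ∷ z ∷ []) → (x ⊗ y) ⊗ z , x ⊗ (y ⊗ z) }) refl

^⊗-+ : ∀ (x : ℕ[ξ]) m n → x ^⊗ (m + n) ≡ x ^⊗ m ⊗ x ^⊗ n
^⊗-+ x zero    n = sym (⊗-identityˡ (x ^⊗ n))
^⊗-+ x (suc m) n = trans (cong (x ⊗_) (^⊗-+ x m n)) (sym (⊗-assoc x (x ^⊗ m) (x ^⊗ n)))

^⊗-* : ∀ (x : ℕ[ξ]) m n → x ^⊗ (m * n) ≡ (x ^⊗ n) ^⊗ m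
^⊗-* x zero    n = refl
^⊗-* x (suc m) n = trans (^⊗-+ x n (m * n)) (cong (x ^⊗ n ⊗_) (^⊗-* x m n))

ξ-⊗ : ∀ (x : ℕ[ξ]) → ξ ⊗ x ≡ ⟨ c₂ x , c₀ x , c₂ x + c₁ x ⟩
ξ-⊗ x = ℕ[ξ]-solve [] (x ∷ []) (λ { [] (x ∷ []) → ξ ⊗ x , ⟨ c₂ x , c₀ x , c₂ x :+ c₁ x ⟩ }) refl

ξ^⊗-narayana : ∀ N → ξ ^⊗ (3 + N) ≡ ⟨ narayana (1 + N) , narayana N , narayana (2 + N) ⟩
ξ^⊗-narayana zero    = refl
ξ^⊗-narayana (suc N) = trans (cong (ξ ⊗_) (ξ^⊗-narayana N)) (ξ-⊗ _)

-- One-sided: every congruence below has a witness with nonnegative coefficients.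
infix 4 _≈_[mod_]

data _≈_[mod_] (x y : ℕ[ξ]) (m : ℕ) : Set where
  _,_ : (z : ℕ[ξ]) → x ≡ y ⊕ m · z → x ≈ y [mod m ]

≡-≈-trans : ∀ {x x′ y m} → x ≡ x′ → x′ ≈ y [mod m ] → x ≈ y [mod m ]
≡-≈-trans refl x′≈y = x′≈y

≈-trans : ∀ {x y y′ m} → x ≈ y [mod m ] → y ≈ y′ [mod m ] → x ≈ y′ [mod m ]
≈-trans {y′ = y′} {m} (z , refl) (z′ , refl) = z′ ⊕ z ,
  ℕ[ξ]-solve (m ∷ []) (y′ ∷ z′ ∷ z ∷ [])
    (λ { (m ∷ []) (y′ ∷ z′ ∷ z ∷ []) → (y′ ⊕ m · z′) ⊕ m · z , y′ ⊕ m · (z′ ⊕ z) }) refl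

≈-⊗ˡ : ∀ (c : ℕ[ξ]) {x y m} → x ≈ y [mod m ] → c ⊗ x ≈ c ⊗ y [mod m ]
≈-⊗ˡ c {y = y} {m} (z , refl) = c ⊗ z ,
  ℕ[ξ]-solve (m ∷ []) (c ∷ y ∷ z ∷ [])
    (λ { (m ∷ []) (c ∷ y ∷ z ∷ []) → c ⊗ (y ⊕ m · z) , c ⊗ y ⊕ m · (c ⊗ z) }) refl

n+m*k≡n[mod-m] : ∀ n m k → (n + m * k) ≡ n [mod m ]
n+m*k≡n[mod-m] n m k = subst (m ∣ℕ_) (sym ∣difference∣) (m∣m*n k)
  where
    open ≡-Reasoning
    ∣difference∣ : ∣ + (n + m * k) -ℤ + n ∣ ≡ m * k
    ∣difference∣ = begin
      ∣ + (n + m * k) -ℤ + n ∣  ≡⟨ cong ∣_∣ ([+m]-[+n]≡m⊖n (n + m * k) n) ⟩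
      ∣ (n + m * k) ⊖ n ∣       ≡⟨ cong ∣_∣ (⊖-≥ (m≤m+n n (m * k))) ⟩
      n + m * k ∸ n             ≡⟨ m+n∸m≡n n (m * k) ⟩
      m * k                     ∎

≈⇒≡[mod] : ∀ {x y m} → x ≈ y [mod m ] →
  (c₀ x ≡ c₀ y [mod m ]) × (c₁ x ≡ c₁ y [mod m ]) × (c₂ x ≡ c₂ y [mod m ])
≈⇒≡[mod] {y = y} {m} (z , refl) =
  n+m*k≡n[mod-m] (c₀ y) m (c₀ z) , n+m*k≡n[mod-m] (c₁ y) m (c₁ z) , n+m*k≡n[mod-m] (c₂ y) m (c₂ z)

⊗-near-one : ∀ d w {x y u v} →
  x ≈ 1ξ ⊕ (d * w) · u [mod d * d * w ] →
  y ≈ 1ξ ⊕ (d * w) · v [mod d * d * w ] →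
  x ⊗ y ≈ 1ξ ⊕ (d * w) · (u ⊕ v) [mod d * d * w ]
⊗-near-one d w {u = u} {v} (z , refl) (z′ , refl) =
  z ⊕ z′ ⊕ w · (u ⊕ d · z) ⊗ (v ⊕ d · z′) ,
  ℕ[ξ]-solve (d ∷ w ∷ []) (u ∷ v ∷ z ∷ z′ ∷ []) (λ { (d ∷ w ∷ []) (u ∷ v ∷ z ∷ z′ ∷ []) →
    (1ξ ⊕ (d :* w) · u ⊕ (d :* d :* w) · z) ⊗ (1ξ ⊕ (d :* w) · v ⊕ (d :* d :* w) · z′) ,
    1ξ ⊕ (d :* w) · (u ⊕ v) ⊕ (d :* d :* w) · (z ⊕ z′ ⊕ w · (u ⊕ d · z) ⊗ (v ⊕ d · z′)) }) refl

^⊗-near-one : ∀ d w {x u} → x ≈ 1ξ ⊕ (d * w) · u [mod d * d * w ] →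
  ∀ s → x ^⊗ s ≈ 1ξ ⊕ (d * w) · (s · u) [mod d * d * w ]
^⊗-near-one d w {u = u} _ zero = 0ξ ,
  ℕ[ξ]-solve (d ∷ w ∷ []) (u ∷ []) (λ { (d ∷ w ∷ []) (u ∷ []) →
    1ξ , 1ξ ⊕ (d :* w) · (# 0 · u) ⊕ (d :* d :* w) · 0ξ }) refl
^⊗-near-one d w x≈ (suc s) = ⊗-near-one d w x≈ (^⊗-near-one d w x≈ s)

-- (1 + dwV)³ = 1 + 3dwV + 3d²w²V² + d³w³V³, and d = 3e makes the last two terms
-- multiples of 3d²w.
cube-near-one : ∀ e w {x u} →
  x ≈ 1ξ ⊕ (3 * e * w) · u [mod 3 * e * (3 * e) * w ] →
  x ^⊗ 3 ≈ 1ξ ⊕ (3 * e * (3 * w)) · u [mod 3 * e * (3 * e) * (3 * w) ]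
cube-near-one e w {u = u} (z , refl) =
  z ⊕ w · V ⊗ V ⊕ (e * w * w) · V ⊗ V ⊗ V ,
  ℕ[ξ]-solve (e ∷ w ∷ []) (u ∷ z ∷ []) (λ { (e ∷ w ∷ []) (u ∷ z ∷ []) →
    let d = # 3 :* e ; V = u ⊕ d · z in
    (1ξ ⊕ (d :* w) · u ⊕ (d :* d :* w) · z) ^⊗ 3 ,
    1ξ ⊕ (d :* (# 3 :* w)) · u
       ⊕ (d :* d :* (# 3 :* w)) · (z ⊕ w · V ⊗ V ⊕ (e :* w :* w) · V ⊗ V ⊗ V) }) refl
  where V = u ⊕ (3 * e) · z

module _ {A : Set} {{_ : Arithmetic A}} where
  B : Triple A
  B = ⟨ # 19 , # 7 , # 17 ⟩

  -- The right-hand sides of the three congruences, with pₖ standing for 3^(n+k).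
  residues : (p₁ p₂ p₃ s : A) → Triple A
  residues p₁ p₂ p₃ s =
    ⟨ p₂ *ᴬ (# 5 *ᴬ s) +ᴬ p₁ *ᴬ s +ᴬ # 1
    , p₃ *ᴬ (# 2 *ᴬ s) +ᴬ p₂ *ᴬ (# 2 *ᴬ s)
    , p₃ *ᴬ (# 2 *ᴬ s) +ᴬ p₂ *ᴬ (# 5 *ᴬ s) +ᴬ # 1 ⟩

-- The witness is (ξ^72 − 1 − 27B)/729, computed from ξ^72 = a(70) + a(69)ξ + a(71)ξ².
ξ^⊗72-near-one : ξ ^⊗ (8 * 3 ^ 2) ≈ 1ξ ⊕ 27 · B [mod 729 ]
ξ^⊗72-near-one = ⟨ 238858950 , 162980103 , 350064806 ⟩ , refl

ξ^⊗[8·3^n]-near-one : ∀ m → ξ ^⊗ (8 * 3 ^ (2 + m)) ≈ 1ξ ⊕ (27 * 3 ^ m) · B [mod 27 * 27 * 3 ^ m ]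
ξ^⊗[8·3^n]-near-one zero    = ξ^⊗72-near-one
ξ^⊗[8·3^n]-near-one (suc m) =
  ≡-≈-trans (trans (cong (ξ ^⊗_) (8*[3*t]≡3*[8*t] (3 ^ (2 + m)))) (^⊗-* ξ 3 (8 * 3 ^ (2 + m))))
            (cube-near-one 9 (3 ^ m) (ξ^⊗[8·3^n]-near-one m))
  where
    8*[3*t]≡3*[8*t] : ∀ t → 8 * (3 * t) ≡ 3 * (8 * t)
    8*[3*t]≡3*[8*t] t = trans (sym (*-assoc 8 3 t)) (*-assoc 3 8 t)

ξ^⊗[8s·3^n]-near-one : ∀ m s →
  ξ ^⊗ (8 * s * 3 ^ (2 + m)) ≈ 1ξ ⊕ (27 * 3 ^ m) · (s · B) [mod 27 * 27 * 3 ^ m ]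
ξ^⊗[8s·3^n]-near-one m s =
  ≡-≈-trans (trans (cong (ξ ^⊗_) (8*s*t≡s*[8*t] (3 ^ (2 + m)))) (^⊗-* ξ s (8 * 3 ^ (2 + m))))
            (^⊗-near-one 27 (3 ^ m) (ξ^⊗[8·3^n]-near-one m) s)
  where
    8*s*t≡s*[8*t] : ∀ t → 8 * s * t ≡ s * (8 * t)
    8*s*t≡s*[8*t] t = trans (cong (_* t) (*-comm 8 s)) (*-assoc s 8 t)

ξ^⊗3⊗-near-one : ∀ w s →
  ξ ^⊗ 3 ⊗ (1ξ ⊕ (27 * w) · (s · B)) ≈ residues (27 * w) (81 * w) (243 * w) s [mod 729 * w ]
ξ^⊗3⊗-near-one w s = s · ⟨ 1 , 0 , 1 ⟩ ,
  ℕ[ξ]-solve (w ∷ s ∷ []) [] (λ { (w ∷ s ∷ []) [] →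
    ξ ^⊗ 3 ⊗ (1ξ ⊕ (# 27 :* w) · (s · B)) ,
    residues (# 27 :* w) (# 81 :* w) (# 243 :* w) s ⊕ (# 729 :* w) · (s · ⟨ # 1 , # 0 , # 1 ⟩) })
    refl

3^[2+m+k] : ∀ m k → 3 ^ (2 + m + k) ≡ 3 ^ (2 + k) * 3 ^ m
3^[2+m+k] m k = trans (cong (3 ^_) 2+m+k≡2+k+m) (^-distribˡ-+-* 3 (2 + k) m)
  where
    2+m+k≡2+k+m : 2 + m + k ≡ 2 + k + m
    2+m+k≡2+k+m = trans (+-assoc 2 m k) (trans (cong (λ i → 2 + i) (+-comm m k)) (sym (+-assoc 2 k m)))

residues-cong : ∀ {p₁ p₂ p₃ q₁ q₂ q₃ : ℕ} s → p₁ ≡ q₁ → p₂ ≡ q₂ → p₃ ≡ q₃ →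
  residues p₁ p₂ p₃ s ≡ residues q₁ q₂ q₃ s
residues-cong s refl refl refl = refl

narayana-≈ : ∀ m s → let n = 2 + m ; N = 8 * s * 3 ^ n in
  ⟨ narayana (N + 1) , narayana N , narayana (N + 2) ⟩
    ≈ residues (3 ^ (n + 1)) (3 ^ (n + 2)) (3 ^ (n + 3)) s [mod 3 ^ (n + 4) ]
narayana-≈ m s =
  subst₂ (λ y M → ⟨ narayana (N + 1) , narayana N , narayana (N + 2) ⟩ ≈ y [mod M ])
    (sym (residues-cong s (3^[2+m+k] m 1) (3^[2+m+k] m 2) (3^[2+m+k] m 3))) (sym (3^[2+m+k] m 4))
    (≡-≈-trans coefficients
      (≈-trans (≈-⊗ˡ (ξ ^⊗ 3) (ξ^⊗[8s·3^n]-near-one m s)) (ξ^⊗3⊗-near-one (3 ^ m) s)))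
  where
    N = 8 * s * 3 ^ (2 + m)
    coefficients : ⟨ narayana (N + 1) , narayana N , narayana (N + 2) ⟩ ≡ ξ ^⊗ 3 ⊗ ξ ^⊗ N
    coefficients = begin
      ⟨ narayana (N + 1) , narayana N , narayana (N + 2) ⟩
        ≡⟨ cong₂ (λ i j → ⟨ narayana i , narayana N , narayana j ⟩) (+-comm N 1) (+-comm N 2) ⟩
      ⟨ narayana (1 + N) , narayana N , narayana (2 + N) ⟩  ≡⟨ ξ^⊗-narayana N ⟨
      ξ ^⊗ (3 + N)                                           ≡⟨ ^⊗-+ ξ 3 N ⟩
      ξ ^⊗ 3 ⊗ ξ ^⊗ N                                        ∎
      where open ≡-Reasoning

proposition3p4 : ∀ (s n : ℕ) → s ≥ 1 → n ≥ 2 →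
    (narayana (8 * s * 3 ^ n) ≡ 3 ^ (n + 3) * (2 * s) + 3 ^ (n + 2) * (2 * s) [mod 3 ^ (n + 4) ])
    × (narayana (8 * s * 3 ^ n + 1) ≡ 3 ^ (n + 2) * (5 * s) + 3 ^ (n + 1) * s + 1 [mod 3 ^ (n + 4) ])
    × (narayana (8 * s * 3 ^ n + 2) ≡ 3 ^ (n + 3) * (2 * s) + 3 ^ (n + 2) * (5 * s) + 1 [mod 3 ^ (n + 4) ])
-- The congruences hold trivially for s = 0 as well.
proposition3p4 s (suc (suc m)) _ (s≤s (s≤s z≤n)) =
  let (a₁ , a₀ , a₂) = ≈⇒≡[mod] (narayana-≈ m s) in a₀ , a₁ , a₂
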